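{- In the $F_4$ Black Hole Zeckendorf game, for all $\alpha,\gamma,k_1,k_3\in\mathbb{Z}_{\ge0}$ with $1\le k_1\le 2$ and $0\le k_3\le 3$, the position $(3\alpha+k_1,1,4\gamma+k_3)$ is an $N$ position.
   Context: The $F_4$ Black Hole Zeckendorf game: a position is a triple $(a,b,c)$ of nonnegative integers, the numbers of pieces in the columns of weights $F_1=1$, $F_2=2$, $F_3=3$. Two players alternate moves; the available moves are: (M) if $a\ge2$, go to $(a-2,b+1,c)$; (A$_1$) if $a,b\ge1$, go to $(a-1,b-1,c+1)$; (A$_2$) if $b,c\ge1$, go to $(a,b-1,c-1)$; (S$_2$) if $b\ge2$, go to $(a+1,b-2,c+1)$; (S$_3$) if $c\ge2$, go to $(a+1,b,c-2)$ (pieces landing in column $F_4=5$, the "black hole", are removed). The player making the last move wins. A position is a $P$ position if the player to move from it loses under optimal play, and an $N$ position if the player to move can force a win; positions with no move are $P$ positions. -}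

module Defs where

open import Data.Nat using (ℕ; zero; suc; _+_; _*_)
open import Data.Product using (_×_; _,_; Σ; ∃)

-- A position (a , b , c): numbers of pieces in columns of weight F₁=1, F₂=2, F₃=3.
Position : Set
Position = ℕ × ℕ × ℕ

-- One legal move of the F₄ Black Hole Zeckendorf game (pieces reaching F₄ = 5 are removed).
data Move : Position → Position → Set where
  M  : ∀ {a b c} → Move (suc (suc a) , b , c) (a , suc b , c)
  A₁ : ∀ {a b c} → Move (suc a , suc b , c) (a , b , suc c)
  A₂ : ∀ {a b c} → Move (a , suc b , suc c) (a , b , c)
  S₂ : ∀ {a b c} → Move (a , suc (suc b) , c) (suc a , b , suc c)
  S₃ : ∀ {a b c} → Move (a , b , suc (suc c)) (suc a , b , c)

data IsP : Position → Set
data IsN : Position → Set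

data IsP where
  allN : ∀ {p} → (∀ {q} → Move p q → IsN q) → IsP p

data IsN where
  someP : ∀ {p q} → Move p q → IsP q → IsN p

-- Playing A₁ from (1 + a , 1 , c) leads to (a , 0 , 1 + c). Either that position is P, or
-- it has a winning move; its only moves are M, to (a − 2 , 1 , 1 + c), and S₃, which leads
-- to the same position as A₂ from (1 + a , 1 , c). So (1 + a , 1 , c) is N unless
-- (a − 2 , 1 , 1 + c) is P. For 1 + a ∈ {1, 2} the move M does not exist, and induction on
-- a in steps of 3 shows that (a , 1 , c) is N for all c whenever 3 ∤ a. The case split
-- relies on determinacy (every position is P or N), which holds because every move
-- decreases the weight 3a + 5b + 6c.
module Submission where

open import Defs
open import Data.Nat using (ℕ; suc; _+_; _*_; _≤_; _<_; s≤s; z≤n; z<s; NonZero)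
open import Data.Nat.Properties using (m<m+n; *-suc)
open import Data.Nat.Induction using (<-wellFounded)
open import Data.Nat.Tactic.RingSolver using (solve-∀)
open import Data.Product using (_,_; ∃; proj₁)
open import Data.Sum using (_⊎_; inj₁; inj₂; [_,_]′)
open import Data.List using (List; []; _∷_; _++_)
open import Data.List.Relation.Unary.Any using (Any; here; any?; satisfied)
open import Data.List.Membership.Propositional using (_∈_; lose)
open import Data.List.Membership.Propositional.Properties using (∈-++⁺ʳ)
open import Function using (_∘_; _on_; id)
open import Induction.WellFounded using (Acc; acc)
open import Relation.Binary.PropositionalEquality using (_≡_; refl; sym; cong; subst)
open import Relation.Nullary using (¬_; Dec; yes; no; contradiction)
import Relation.Binary.Construct.On as On

IsP⇒¬IsN : ∀ {p} → IsP p → ¬ IsN p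
IsP⇒¬IsN (allN toN) (someP m P) = IsP⇒¬IsN P (toN m)

weight : Position → ℕ
weight (a , b , c) = a * 3 + b * 5 + c * 6

m+k≡n⇒m<n : ∀ {m n k} → .{{NonZero k}} → m + k ≡ n → m < n
m+k≡n⇒m<n {m} {k = suc k} refl = m<m+n m z<s

-- Stated on the explicit formula, since the ring solver cannot see through weight.
M-weight : ∀ a b c → a * 3 + (1 + b) * 5 + c * 6 + 1 ≡ (2 + a) * 3 + b * 5 + c * 6
M-weight = solve-∀

A₁-weight : ∀ a b c → a * 3 + b * 5 + (1 + c) * 6 + 2 ≡ (1 + a) * 3 + (1 + b) * 5 + c * 6
A₁-weight = solve-∀

A₂-weight : ∀ a b c → a * 3 + b * 5 + c * 6 + 11 ≡ a * 3 + (1 + b) * 5 + (1 + c) * 6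
A₂-weight = solve-∀

S₂-weight : ∀ a b c → (1 + a) * 3 + b * 5 + (1 + c) * 6 + 1 ≡ a * 3 + (2 + b) * 5 + c * 6
S₂-weight = solve-∀

S₃-weight : ∀ a b c → (1 + a) * 3 + b * 5 + c * 6 + 9 ≡ a * 3 + b * 5 + (2 + c) * 6
S₃-weight = solve-∀

weight-decreasing : ∀ {p q} → Move p q → weight q < weight p
weight-decreasing (M  {a} {b} {c}) = m+k≡n⇒m<n (M-weight a b c)
weight-decreasing (A₁ {a} {b} {c}) = m+k≡n⇒m<n (A₁-weight a b c)
weight-decreasing (A₂ {a} {b} {c}) = m+k≡n⇒m<n (A₂-weight a b c)
weight-decreasing (S₂ {a} {b} {c}) = m+k≡n⇒m<n (S₂-weight a b c)
weight-decreasing (S₃ {a} {b} {c}) = m+k≡n⇒m<n (S₃-weight a b c)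

M-moves A₁-moves A₂-moves S₂-moves S₃-moves : (p : Position) → List (∃ (Move p))
M-moves (suc (suc a) , b , c) = (_ , M) ∷ []
M-moves _ = []
A₁-moves (suc a , suc b , c) = (_ , A₁) ∷ []
A₁-moves _ = []
A₂-moves (a , suc b , suc c) = (_ , A₂) ∷ []
A₂-moves _ = []
S₂-moves (a , suc (suc b) , c) = (_ , S₂) ∷ []
S₂-moves _ = []
S₃-moves (a , b , suc (suc c)) = (_ , S₃) ∷ []
S₃-moves _ = []

moves : (p : Position) → List (∃ (Move p))
moves p = M-moves p ++ A₁-moves p ++ A₂-moves p ++ S₂-moves p ++ S₃-moves p

moves-complete : ∀ {p q} (m : Move p q) → (q , m) ∈ moves p
moves-complete M = here refl
moves-complete {p} A₁ = ∈-++⁺ʳ (M-moves p) (here refl)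
moves-complete {p} A₂ = ∈-++⁺ʳ (M-moves p) (∈-++⁺ʳ (A₁-moves p) (here refl))
moves-complete {p} S₂ =
  ∈-++⁺ʳ (M-moves p) (∈-++⁺ʳ (A₁-moves p) (∈-++⁺ʳ (A₂-moves p) (here refl)))
moves-complete {p} S₃ =
  ∈-++⁺ʳ (M-moves p) (∈-++⁺ʳ (A₁-moves p) (∈-++⁺ʳ (A₂-moves p) (∈-++⁺ʳ (S₂-moves p) (here refl))))

determined-by-successors : ∀ {p} → (∀ {q} → Move p q → IsP q ⊎ IsN q) → IsP p ⊎ IsN p
determined-by-successors {p} successor-determined = decide (any? leads-to-P? (moves p))
  where
  leads-to-P? : (move : ∃ (Move p)) → Dec (IsP (proj₁ move))
  leads-to-P? (_ , m) = [ yes , (λ N → no (λ P → IsP⇒¬IsN P N)) ]′ (successor-determined m)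

  decide : Dec (Any (IsP ∘ proj₁) (moves p)) → IsP p ⊎ IsN p
  decide (yes found) with satisfied found
  ... | (_ , m) , P = inj₂ (someP m P)
  decide (no none) = inj₁ (allN λ m →
    [ (λ P → contradiction (lose (moves-complete m) P) none) , id ]′ (successor-determined m))

determined-acc : ∀ {p} → Acc (_<_ on weight) p → IsP p ⊎ IsN p
determined-acc (acc smaller) =
  determined-by-successors λ m → determined-acc (smaller (weight-decreasing m))

determined : ∀ p → IsP p ⊎ IsN p
determined p = determined-acc (On.wellFounded weight <-wellFounded p)

IsN-via-A₁-or-A₂ : ∀ {a c} → (∀ {a′} → Move (a , 0 , suc c) (a′ , 1 , suc c) → ¬ IsP (a′ , 1 , suc c)) →
  IsN (suc a , 1 , c)
IsN-via-A₁-or-A₂ {a} {c} no-winning-M with determined (a , 0 , suc c)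
... | inj₁ P = someP A₁ P
... | inj₂ (someP M P) = contradiction P (no-winning-M M)
... | inj₂ (someP S₃ P) = someP A₂ P

IsN-3+ : ∀ {a} → (∀ c → IsN (a , 1 , c)) → ∀ c → IsN (3 + a , 1 , c)
IsN-3+ N c = IsN-via-A₁-or-A₂ λ { M P → IsP⇒¬IsN P (N (suc c)) }

IsN-3α+k : ∀ α {k} → 1 ≤ k → k ≤ 2 → ∀ c → IsN (3 * α + k , 1 , c)
IsN-3α+k 0 (s≤s z≤n) (s≤s z≤n) c = IsN-via-A₁-or-A₂ λ ()
IsN-3α+k 0 (s≤s z≤n) (s≤s (s≤s z≤n)) c = IsN-via-A₁-or-A₂ λ ()
IsN-3α+k (suc α) {k} 1≤k k≤2 c =
  subst (λ a → IsN (a , 1 , c)) (cong (_+ k) (sym (*-suc 3 α))) (IsN-3+ (IsN-3α+k α 1≤k k≤2) c)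

-- The number of pieces in the F₃ column is arbitrary.
lemma5p5 : ∀ (α γ k₁ k₃ : ℕ) → 1 ≤ k₁ → k₁ ≤ 2 → k₃ ≤ 3 →
    IsN (3 * α + k₁ , 1 , 4 * γ + k₃)
lemma5p5 α γ k₁ k₃ 1≤k₁ k₁≤2 _ = IsN-3α+k α 1≤k₁ k₁≤2 (4 * γ + k₃)
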